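{- Let $\Gamma$ be a finite simple graph, and define $\tilde\Gamma^{(0)}=\Gamma$ and, for $i\ge1$, $\tilde\Gamma^{(i)}$ to be the prime graph of $SEP(\tilde\Gamma^{(i-1)})$. Then the SEP $\Gamma$-series has finite length: there exists an integer $m\ge1$ such that $\tilde\Gamma^{(m)}$ has no vertices.
   Context: Two vertices $u,v$ of a graph are structurally equivalent if the transposition $(u\,v)$ (swapping $u,v$, fixing other vertices) is an automorphism; $SEP(\Gamma)=\langle\{(u\,v) : (u\,v)\in \mathrm{Aut}(\Gamma)\}\rangle$. The prime graph of a finite group $G$ has as vertices the primes dividing $|G|$, distinct primes $p,q$ being adjacent iff $G$ has an element of order $pq$ (for the trivial group it has no vertices). The sequence $\tilde\Gamma^{(0)},\tilde\Gamma^{(1)},\dots$ up to the last graph before the empty graph is called the SEP $\Gamma$-series; its last nonempty term is its minimal element. -}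

module Defs where

open import Level using (0ℓ)
open import Data.Nat using (ℕ; zero; suc; _*_; _<_; _≤_)
open import Data.Nat.Divisibility using (_∣_)
open import Data.Nat.Primality using (Prime)
open import Data.Fin using (Fin)
open import Data.Fin.Permutation.Components using (transpose)
open import Data.Product using (Σ; ∃; _×_)
open import Function using (id; _∘_)
open import Function.Bundles using (_⇔_)
open import Relation.Nullary using (¬_)
open import Relation.Binary.PropositionalEquality using (_≡_; _≢_)

record Graph : Set₁ where
  field
    n      : ℕ
    Adj    : Fin n → Fin n → Set
    sym    : ∀ {x y} → Adj x y → Adj y x
    irrefl : ∀ {x} → ¬ Adj x x

-- Permutations of Fin n are represented as maps Fin n → Fin n,
-- compared pointwise.

_≈_ : ∀ {n} → (Fin n → Fin n) → (Fin n → Fin n) → Set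
σ ≈ τ = ∀ x → σ x ≡ τ x

iter : ∀ {n} → (Fin n → Fin n) → ℕ → (Fin n → Fin n)
iter σ zero    = id
iter σ (suc k) = σ ∘ iter σ k

HasOrder : ∀ {n} → (Fin n → Fin n) → ℕ → Set
HasOrder σ k = (0 < k) × (iter σ k ≈ id) × (∀ j → 0 < j → j < k → ¬ (iter σ j ≈ id))

TranspAut : (Γ : Graph) → Fin (Graph.n Γ) → Fin (Graph.n Γ) → Set
TranspAut Γ u v = u ≢ v ×
  (∀ x y → Adj x y ⇔ Adj (transpose u v x) (transpose u v y))
  where open Graph Γ

-- membership in the subgroup generated by those transpositions
-- (finite group: closure under identity and products suffices;
--  closed under pointwise equality)
data InSEP (Γ : Graph) : (Fin (Graph.n Γ) → Fin (Graph.n Γ)) → Set where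
  gen-id   : InSEP Γ id
  gen-step : ∀ {u v σ} → TranspAut Γ u v → InSEP Γ σ → InSEP Γ (transpose u v ∘ σ)
  gen-ext  : ∀ {σ τ} → InSEP Γ σ → σ ≈ τ → InSEP Γ τ

HasSize : ∀ {n} → ((Fin n → Fin n) → Set) → ℕ → Set
HasSize {n} G k = Σ (Fin k → (Fin n → Fin n)) λ e →
    (∀ i → G (e i))
  × (∀ i j → e i ≈ e j → i ≡ j)
  × (∀ σ → G σ → ∃ λ i → e i ≈ σ)

-- Δ is (isomorphic to) the prime graph of the permutation group G:
-- ι labels the vertices of Δ bijectively by the primes dividing |G|,
-- and distinct labels p, q are adjacent iff G has an element of order pq.

IsPrimeGraph : ∀ {n} → ((Fin n → Fin n) → Set) → Graph → Set
IsPrimeGraph {n} G Δ = Σ ℕ λ k → HasSize G k × Σ (Fin (Graph.n Δ) → ℕ) λ ι →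
    (∀ i j → ι i ≡ ι j → i ≡ j)
  × (∀ i → Prime (ι i) × ι i ∣ k)
  × (∀ p → Prime p → p ∣ k → ∃ λ i → ι i ≡ p)
  × (∀ i j → Graph.Adj Δ i j ⇔
        (ι i ≢ ι j × Σ (Fin n → Fin n) λ σ → G σ × HasOrder σ (ι i * ι j)))

IsPrimeGraphOfSEP : Graph → Graph → Set
IsPrimeGraphOfSEP Γ Δ = IsPrimeGraph (InSEP Γ) Δ

-- Every prime dividing the order of a permutation group of degree n is at most n: by
-- orbit–stabilizer, |G| = |orbit of a point| · |stabilizer|, the orbit has at most n
-- points, and the stabilizer fixes one more point, so a prime divisor of |G| divides
-- either an orbit length or the order of a group fixing every point, which is 1.
-- Hence the prime graph of SEP(Γ) has at most n − 1 vertices (distinct primes in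
-- [2, n]), the vertex counts along the series drop by at least one at each step, and
-- the (n + 1)-st term is empty.
module Submission where

open import Defs
open import Data.Nat using (ℕ; zero; suc; pred; _≤_; _<_; _+_; _*_; _∸_; z≤n; s≤s; NonZero; nonTrivial⇒n>1)
open import Data.Nat.Properties using (≤-trans; ≤-refl; ≤-antisym; ≤-pred; +-suc; +-identityʳ; m≤m+n; m≤n⇒m<n∨m≡n; n≤1+n; n≤0⇒n≡0; m≤n⇒m∸n≡0; ∸-cancelʳ-≡; pred-mono-≤; pred[m∸n]≡m∸[1+n])
open import Data.Nat.Divisibility using (_∣_; ∣⇒≤; ∣1⇒≡1)
open import Data.Nat.Primality using (Prime; euclidsLemma; prime⇒nonTrivial; ¬prime[1])
open import Data.Fin as Fin using (Fin; toℕ; fromℕ<; remQuot; combine)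
open import Data.Fin.Properties using (_≟_; any?; injective⇒≤; suc-injective; toℕ-injective; toℕ-fromℕ<; toℕ<n; combine-remQuot; remQuot-combine; nonZeroIndex)
open import Data.Fin.Permutation.Components using (transpose; transpose-inverse)
open import Data.Product using (∃; _×_; Σ; _,_; proj₁; proj₂; uncurry)
open import Data.Sum as Sum using (_⊎_; inj₁; inj₂; [_,_]′)
open import Data.Empty using (⊥-elim)
open import Function using (id; _∘_)
open import Relation.Nullary using (¬_; Dec; yes; no)
open import Relation.Nullary.Decidable using (dec-true; dec-false)
open import Relation.Unary using (Decidable)
open import Relation.Binary.PropositionalEquality using (_≡_; refl; sym; trans; cong; cong₂; subst; module ≡-Reasoning)

Perm : ℕ → Set
Perm n = Fin n → Fin n

record IsPermGroup {n} (G : Perm n → Set) : Set where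
  field
    ≈-closed : ∀ {σ τ} → G σ → σ ≈ τ → G τ
    id-closed : G id
    ∘-closed : ∀ {σ τ} → G σ → G τ → G (σ ∘ τ)
    inverse : ∀ {σ} → G σ → Σ (Perm n) λ τ → G τ × (τ ∘ σ) ≈ id × (σ ∘ τ) ≈ id

transpose-matchˡ : ∀ {n} (i j : Fin n) → transpose i j i ≡ j
transpose-matchˡ i j rewrite dec-true (i ≟ i) refl = refl

transpose-matchʳ : ∀ {n} (i j : Fin n) → transpose i j j ≡ i
transpose-matchʳ i j with j ≟ i
... | yes j≡i = j≡i
... | no _ rewrite dec-true (j ≟ j) refl = refl

transpose-other : ∀ {n} {i j k : Fin n} → ¬ k ≡ i → ¬ k ≡ j → transpose i j k ≡ k
transpose-other {i = i} {j} {k} k≢i k≢j rewrite dec-false (k ≟ i) k≢i | dec-false (k ≟ j) k≢j = refl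

transpose-sym : ∀ {n} (i j k : Fin n) → transpose i j k ≡ transpose j i k
transpose-sym i j k = cases (k ≟ i) (k ≟ j)
  where
  cases : Dec (k ≡ i) → Dec (k ≡ j) → transpose i j k ≡ transpose j i k
  cases (yes refl) (yes refl) = refl
  cases (yes refl) (no _) = trans (transpose-matchˡ k j) (sym (transpose-matchʳ j k))
  cases (no _) (yes refl) = trans (transpose-matchʳ i k) (sym (transpose-matchˡ k i))
  cases (no k≢i) (no k≢j) = trans (transpose-other k≢i k≢j) (sym (transpose-other k≢j k≢i))

transpose-involutive : ∀ {n} (i j k : Fin n) → transpose i j (transpose i j k) ≡ k
transpose-involutive i j k = trans (cong (transpose i j) (transpose-sym i j k)) (transpose-inverse i j)

module _ (Γ : Graph) where

  SEP-∘-closed : ∀ {σ τ} → InSEP Γ σ → InSEP Γ τ → InSEP Γ (σ ∘ τ)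
  SEP-∘-closed gen-id t = t
  SEP-∘-closed (gen-step uv s) t = gen-step uv (SEP-∘-closed s t)
  SEP-∘-closed {τ = τ} (gen-ext s σ≈σ′) t = gen-ext (SEP-∘-closed s t) (σ≈σ′ ∘ τ)

  SEP-inverse : ∀ {σ} → InSEP Γ σ →
    Σ (Perm (Graph.n Γ)) λ τ → InSEP Γ τ × (τ ∘ σ) ≈ id × (σ ∘ τ) ≈ id
  SEP-inverse gen-id = id , gen-id , (λ _ → refl) , (λ _ → refl)
  SEP-inverse (gen-step {u} {v} {σ} uv s) with SEP-inverse s
  ... | τ , τ∈SEP , τσ≈id , στ≈id =
    τ ∘ transpose u v , SEP-∘-closed τ∈SEP (gen-step uv gen-id) ,
    (λ x → trans (cong τ (transpose-involutive u v (σ x))) (τσ≈id x)) ,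
    (λ x → trans (cong (transpose u v) (στ≈id (transpose u v x))) (transpose-involutive u v x))
  SEP-inverse (gen-ext s σ≈σ′) with SEP-inverse s
  ... | τ , τ∈SEP , τσ≈id , στ≈id =
    τ , τ∈SEP , (λ x → trans (cong τ (sym (σ≈σ′ x))) (τσ≈id x)) ,
    (λ x → trans (sym (σ≈σ′ (τ x))) (στ≈id x))

  SEP-isPermGroup : IsPermGroup (InSEP Γ)
  SEP-isPermGroup = record
    { ≈-closed = gen-ext ; id-closed = gen-id ; ∘-closed = SEP-∘-closed ; inverse = SEP-inverse }

record Enumeration {k} (P : Fin k → Set) : Set where
  field
    size : ℕ
    elem : Fin size → Fin k
    injective : ∀ a b → elem a ≡ elem b → a ≡ b
    sound : ∀ a → P (elem a)
    complete : ∀ i → P i → ∃ λ a → elem a ≡ i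

enumerate : ∀ {k} {P : Fin k → Set} → Decidable P → Enumeration P
enumerate {zero} _ = record
  { size = 0 ; elem = λ () ; injective = λ () ; sound = λ () ; complete = λ () }
enumerate {suc k} {P} P? with enumerate (P? ∘ Fin.suc) | P? Fin.zero
... | E | yes P0 = record
  { size = suc size ; elem = elem′ ; injective = injective′ ; sound = sound′ ; complete = complete′ }
  where
  open Enumeration E
  elem′ : Fin (suc size) → Fin (suc k)
  elem′ Fin.zero = Fin.zero
  elem′ (Fin.suc a) = Fin.suc (elem a)
  injective′ : ∀ a b → elem′ a ≡ elem′ b → a ≡ b
  injective′ Fin.zero Fin.zero _ = refl
  injective′ (Fin.suc a) (Fin.suc b) eq = cong Fin.suc (injective a b (suc-injective eq))
  sound′ : ∀ a → P (elem′ a)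
  sound′ Fin.zero = P0
  sound′ (Fin.suc a) = sound a
  complete′ : ∀ i → P i → ∃ λ a → elem′ a ≡ i
  complete′ Fin.zero _ = Fin.zero , refl
  complete′ (Fin.suc i) Pi with complete i Pi
  ... | a , refl = Fin.suc a , refl
... | E | no ¬P0 = record
  { size = size ; elem = Fin.suc ∘ elem
  ; injective = λ a b eq → injective a b (suc-injective eq)
  ; sound = sound ; complete = complete′ }
  where
  open Enumeration E
  complete′ : ∀ i → P i → ∃ λ a → Fin.suc (elem a) ≡ i
  complete′ Fin.zero P0 = ⊥-elim (¬P0 P0)
  complete′ (Fin.suc i) Pi with complete i Pi
  ... | a , refl = a , refl

Stabilizer : ∀ {n} → (Perm n → Set) → Fin n → Perm n → Set
Stabilizer G x σ = G σ × σ x ≡ x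

module _ {n} {G : Perm n → Set} where

  HasSize-≤ : ∀ {k k′} → HasSize G k → HasSize G k′ → k ≤ k′
  HasSize-≤ {k} {k′} (e , e∈G , e-inj , _) (e′ , _ , _ , e′-onto) =
    injective⇒≤ {f = index′} index′-injective
    where
    index′ : Fin k → Fin k′
    index′ i = proj₁ (e′-onto (e i) (e∈G i))
    index′-injective : ∀ {i j} → index′ i ≡ index′ j → i ≡ j
    index′-injective {i} {j} eq = e-inj i j λ x →
      trans (sym (proj₂ (e′-onto (e i) (e∈G i)) x))
            (trans (cong (λ a → e′ a x) eq) (proj₂ (e′-onto (e j) (e∈G j)) x))

  HasSize-unique : ∀ {k k′} → HasSize G k → HasSize G k′ → k ≡ k′
  HasSize-unique s s′ = ≤-antisym (HasSize-≤ s s′) (HasSize-≤ s′ s)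

  HasSize-trivial : IsPermGroup G → (∀ σ → G σ → σ ≈ id) → HasSize G 1
  HasSize-trivial G-group trivial =
    (λ _ → id) , (λ _ → id-closed) , (λ { Fin.zero Fin.zero _ → refl }) ,
    (λ σ σ∈G → Fin.zero , λ x → sym (trivial σ σ∈G x))
    where open IsPermGroup G-group

  stabilizer-isPermGroup : IsPermGroup G → ∀ x → IsPermGroup (Stabilizer G x)
  stabilizer-isPermGroup G-group x = record
    { ≈-closed = λ { (σ∈G , σx≡x) σ≈τ → ≈-closed σ∈G σ≈τ , trans (sym (σ≈τ x)) σx≡x }
    ; id-closed = id-closed , refl
    ; ∘-closed = λ { {σ} (σ∈G , σx≡x) (τ∈G , τx≡x) → ∘-closed σ∈G τ∈G , trans (cong σ τx≡x) σx≡x }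
    ; inverse = λ { (σ∈G , σx≡x) → let (τ , τ∈G , τσ≈id , στ≈id) = inverse σ∈G in
                    τ , (τ∈G , trans (cong τ (sym σx≡x)) (τσ≈id x)) , τσ≈id , στ≈id }
    }
    where open IsPermGroup G-group

module OrbitStabilizer {n} {G : Perm n → Set} (G-group : IsPermGroup G)
                       {k} (G-size : HasSize G k) (x : Fin n) where

  open IsPermGroup G-group

  private
    e : Fin k → Perm n
    e = proj₁ G-size
    e∈G : ∀ i → G (e i)
    e∈G = proj₁ (proj₂ G-size)
    e-injective : ∀ i j → e i ≈ e j → i ≡ j
    e-injective = proj₁ (proj₂ (proj₂ G-size))
    e-onto : ∀ σ → G σ → ∃ λ i → e i ≈ σ
    e-onto = proj₂ (proj₂ (proj₂ G-size))

  module Stab = Enumeration (enumerate (λ i → e i x ≟ x))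
  module Orbit = Enumeration (enumerate (λ y → any? (λ i → e i x ≟ y)))

  stabilizer-size : HasSize (Stabilizer G x) Stab.size
  stabilizer-size =
    e ∘ Stab.elem , (λ a → e∈G (Stab.elem a) , Stab.sound a) ,
    (λ a b ea≈eb → Stab.injective a b (e-injective _ _ ea≈eb)) ,
    λ σ (σ∈G , σx≡x) → let (i , eᵢ≈σ) = e-onto σ σ∈G
                           (a , aᵢ) = Stab.complete i (trans (eᵢ≈σ x) σx≡x)
                       in a , λ y → trans (cong (λ c → e c y) aᵢ) (eᵢ≈σ y)

  stabilizer-onto : ∀ σ → Stabilizer G x σ → ∃ λ b → e (Stab.elem b) ≈ σ
  stabilizer-onto = proj₂ (proj₂ (proj₂ stabilizer-size))

  orbit≤n : Orbit.size ≤ n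
  orbit≤n = injective⇒≤ {f = Orbit.elem} (Orbit.injective _ _)

  orbit-nonZero : NonZero Orbit.size
  orbit-nonZero = let (i , eᵢ≈id) = e-onto id id-closed in
    nonZeroIndex (proj₁ (Orbit.complete x (i , eᵢ≈id x)))

  representative : Fin Orbit.size → Perm n
  representative a = e (proj₁ (Orbit.sound a))

  representative∈G : ∀ a → G (representative a)
  representative∈G a = e∈G (proj₁ (Orbit.sound a))

  representative-maps : ∀ a → representative a x ≡ Orbit.elem a
  representative-maps a = proj₂ (Orbit.sound a)

  coset : Fin Orbit.size × Fin Stab.size → Perm n
  coset (a , b) = representative a ∘ e (Stab.elem b)

  coset-injective : ∀ c d → coset c ≈ coset d → c ≡ d
  coset-injective (a , b) (a′ , b′) eq = cong₂ _,_ a≡a′ b≡b′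
    where
    open ≡-Reasoning
    a≡a′ : a ≡ a′
    a≡a′ = Orbit.injective a a′ (begin
      Orbit.elem a                                   ≡⟨ sym (representative-maps a) ⟩
      representative a x                             ≡⟨ cong (representative a) (sym (Stab.sound b)) ⟩
      representative a (e (Stab.elem b) x)           ≡⟨ eq x ⟩
      representative a′ (e (Stab.elem b′) x)         ≡⟨ cong (representative a′) (Stab.sound b′) ⟩
      representative a′ x                            ≡⟨ representative-maps a′ ⟩
      Orbit.elem a′                                  ∎)
    b≡b′ : b ≡ b′
    b≡b′ with inverse (representative∈G a)
    ... | ρ , _ , ρr≈id , _ = Stab.injective b b′ (e-injective _ _ λ y → begin
      e (Stab.elem b) y                              ≡⟨ sym (ρr≈id _) ⟩
      ρ (coset (a , b) y)                            ≡⟨ cong ρ (eq y) ⟩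
      ρ (coset (a′ , b′) y)                          ≡⟨ cong (λ a″ → ρ (coset (a″ , b′) y)) (sym a≡a′) ⟩
      ρ (coset (a , b′) y)                           ≡⟨ ρr≈id _ ⟩
      e (Stab.elem b′) y                             ∎)

  orbitIndex : ∀ σ → G σ → ∃ λ a → Orbit.elem a ≡ σ x
  orbitIndex σ σ∈G = let (i , eᵢ≈σ) = e-onto σ σ∈G in Orbit.complete (σ x) (i , eᵢ≈σ x)

  coset-onto : ∀ σ → G σ → ∃ λ c → coset c ≈ σ
  coset-onto σ σ∈G with orbitIndex σ σ∈G
  ... | a , a↦σx with inverse (representative∈G a)
  ...   | ρ , ρ∈G , ρr≈id , rρ≈id with stabilizer-onto (ρ ∘ σ)
          (∘-closed ρ∈G σ∈G , trans (cong ρ (sym (trans (representative-maps a) a↦σx))) (ρr≈id x))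
  ...     | b , eb≈ρσ = (a , b) , λ y → trans (cong (representative a) (eb≈ρσ y)) (rρ≈id (σ y))

  split : Fin (Orbit.size * Stab.size) → Fin Orbit.size × Fin Stab.size
  split = remQuot {Orbit.size} Stab.size

  coset-size : HasSize G (Orbit.size * Stab.size)
  coset-size =
    coset ∘ split ,
    (λ _ → ∘-closed (representative∈G _) (e∈G _)) ,
    (λ c d eq → begin
      c                         ≡⟨ sym (combine-remQuot {Orbit.size} Stab.size c) ⟩
      uncurry combine (split c) ≡⟨ cong (uncurry combine) (coset-injective _ _ eq) ⟩
      uncurry combine (split d) ≡⟨ combine-remQuot {Orbit.size} Stab.size d ⟩
      d                         ∎) ,
    λ σ σ∈G → let ((a , b) , c≈σ) = coset-onto σ σ∈G in
      combine a b , λ y → trans (cong (λ c → coset c y) (remQuot-combine a b)) (c≈σ y)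
    where open ≡-Reasoning

  size≡orbit*stabilizer : k ≡ Orbit.size * Stab.size
  size≡orbit*stabilizer = HasSize-unique G-size coset-size

  prime∣size⇒≤n⊎∣stabilizer : ∀ {p} → Prime p → p ∣ k → p ≤ n ⊎ p ∣ Stab.size
  prime∣size⇒≤n⊎∣stabilizer {p} p-prime p∣k =
    Sum.map₁ (λ p∣orbit → ≤-trans (∣⇒≤ {{orbit-nonZero}} p∣orbit) orbit≤n)
      (euclidsLemma Orbit.size Stab.size p-prime (subst (p ∣_) size≡orbit*stabilizer p∣k))

FixesBelow : ∀ {n} → ℕ → Perm n → Set
FixesBelow j σ = ∀ x → toℕ x < j → σ x ≡ x

FixesBelow-suc : ∀ {n j} (j<n : j < n) {σ : Perm n} →
  FixesBelow j σ → σ (fromℕ< j<n) ≡ fromℕ< j<n → FixesBelow (suc j) σ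
FixesBelow-suc j<n {σ} fixes σj≡j x x<1+j with m≤n⇒m<n∨m≡n (≤-pred x<1+j)
... | inj₁ x<j = fixes x x<j
... | inj₂ x≡j = subst (λ y → σ y ≡ y) (toℕ-injective (trans (toℕ-fromℕ< j<n) (sym x≡j))) σj≡j

-- Induction on d, the number of points G may still move: the stabilizer of point j fixes one more.
prime∣size⇒≤-fixingBelow : ∀ {n} {G : Perm n → Set} {k p} d j → j + d ≡ n → IsPermGroup G →
  (∀ σ → G σ → FixesBelow j σ) → HasSize G k → Prime p → p ∣ k → p ≤ n
prime∣size⇒≤-fixingBelow {n} {G} {k} {p} zero j j+0≡n G-group fixes G-size p-prime p∣k =
  ⊥-elim (¬prime[1] (subst Prime (∣1⇒≡1 (subst (p ∣_) k≡1 p∣k)) p-prime))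
  where
  j≡n : j ≡ n
  j≡n = trans (sym (+-identityʳ j)) j+0≡n
  k≡1 : k ≡ 1
  k≡1 = HasSize-unique G-size (HasSize-trivial G-group λ σ σ∈G x →
          fixes σ σ∈G x (subst (toℕ x <_) (sym j≡n) (toℕ<n x)))
prime∣size⇒≤-fixingBelow {n} {G} {k} {p} (suc d) j j+1+d≡n G-group fixes G-size p-prime p∣k =
  [ id , recurse ]′ (prime∣size⇒≤n⊎∣stabilizer p-prime p∣k)
  where
  j<n : j < n
  j<n = subst (j <_) j+1+d≡n (subst (suc j ≤_) (sym (+-suc j d)) (m≤m+n (suc j) d))
  open OrbitStabilizer G-group G-size (fromℕ< j<n)
  recurse : p ∣ Stab.size → p ≤ n
  recurse = prime∣size⇒≤-fixingBelow d (suc j) (trans (sym (+-suc j d)) j+1+d≡n)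
    (stabilizer-isPermGroup G-group (fromℕ< j<n))
    (λ σ (σ∈G , σj≡j) → FixesBelow-suc j<n (fixes σ σ∈G) σj≡j)
    stabilizer-size p-prime

prime∣size⇒≤degree : ∀ {n} {G : Perm n → Set} {k p} → IsPermGroup G → HasSize G k →
  Prime p → p ∣ k → p ≤ n
prime∣size⇒≤degree {n} G-group = prime∣size⇒≤-fixingBelow n 0 refl G-group (λ _ _ _ ())

prime⇒2≤ : ∀ {p} → Prime p → 2 ≤ p
prime⇒2≤ {p} p-prime = nonTrivial⇒n>1 p {{prime⇒nonTrivial p-prime}}

∸2<pred : ∀ {q n} → 2 ≤ q → q ≤ n → q ∸ 2 < pred n
∸2<pred {suc (suc _)} {suc _} (s≤s (s≤s z≤n)) (s≤s q<n) = q<n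

primeGraph-size≤pred : ∀ {n} {G : Perm n → Set} {Δ : Graph} → IsPermGroup G →
  IsPrimeGraph G Δ → Graph.n Δ ≤ pred n
primeGraph-size≤pred {n} {Δ = Δ} G-group (_ , G-size , ι , ι-injective , ι-prime∣ , _) =
  injective⇒≤ {f = shifted} shifted-injective
  where
  -- The labels are distinct primes in [2, n], so ι ∸ 2 injects the vertices into Fin (pred n).
  2≤ι : ∀ i → 2 ≤ ι i
  2≤ι i = prime⇒2≤ (proj₁ (ι-prime∣ i))
  ι≤n : ∀ i → ι i ≤ n
  ι≤n i = prime∣size⇒≤degree G-group G-size (proj₁ (ι-prime∣ i)) (proj₂ (ι-prime∣ i))
  shifted : Fin (Graph.n Δ) → Fin (pred n)
  shifted i = fromℕ< (∸2<pred (2≤ι i) (ι≤n i))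
  shifted-injective : ∀ {i j} → shifted i ≡ shifted j → i ≡ j
  shifted-injective {i} {j} eq = ι-injective i j (∸-cancelʳ-≡ (2≤ι i) (2≤ι j)
    (trans (sym (toℕ-fromℕ< _)) (trans (cong toℕ eq) (toℕ-fromℕ< _))))

pred-decreasing⇒vanishes : (a : ℕ → ℕ) → (∀ i → a (suc i) ≤ pred (a i)) → a (suc (a 0)) ≡ 0
pred-decreasing⇒vanishes a decreasing =
  n≤0⇒n≡0 (subst (a (suc (a 0)) ≤_) (m≤n⇒m∸n≡0 (n≤1+n (a 0))) (a≤a₀∸ (suc (a 0))))
  where
  a≤a₀∸ : ∀ i → a i ≤ a 0 ∸ i
  a≤a₀∸ zero = ≤-refl
  a≤a₀∸ (suc i) = ≤-trans (decreasing i)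
    (subst (pred (a i) ≤_) (pred[m∸n]≡m∸[1+n] (a 0) i) (pred-mono-≤ (a≤a₀∸ i)))

theorem3p6 : (Γ : Graph) → (Γs : ℕ → Graph) → Γs 0 ≡ Γ →
    (∀ i → IsPrimeGraphOfSEP (Γs i) (Γs (suc i))) →
    ∃ λ m → 1 ≤ m × Graph.n (Γs m) ≡ 0
theorem3p6 _ Γs _ step =
  suc (Graph.n (Γs 0)) , s≤s z≤n ,
  pred-decreasing⇒vanishes (Graph.n ∘ Γs) λ i →
    primeGraph-size≤pred {Δ = Γs (suc i)} (SEP-isPermGroup (Γs i)) (step i)
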